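{- Let $n\ge 4$ and let $A=\{\overline{1}[n],\ 1\cdot\overline{0}[n-1],\ \overline{0}[n-1]\cdot 1\}$. If $\mathbf{x}\in\mathbb{F}_2^n$, $\mathbf{x}\neq\mathbf{0}$ and $\mathbf{x}\notin A$, then $|T(\mathbf{x})|>n$.
   Context: For $\mathbf{x}=(x_0,\ldots,x_{n-1})\in\mathbb{F}_2^n$, the derivative is $\partial\mathbf{x}=(x_0+x_1,\ldots,x_{n-2}+x_{n-1})\in\mathbb{F}_2^{n-1}$, with $\partial^0\mathbf{x}=\mathbf{x}$ and $\partial^i\mathbf{x}=\partial(\partial^{i-1}\mathbf{x})$. The Steinhaus triangle is $T(\mathbf{x})=(\mathbf{x},\partial\mathbf{x},\ldots,\partial^{n-1}\mathbf{x})$; $|\mathbf{y}|$ is the number of ones of a binary sequence and $|T(\mathbf{x})|=\sum_{i=0}^{n-1}|\partial^i\mathbf{x}|$. $\mathbf{0}$ is the all-zero sequence. Sequences are written as words; a dot denotes concatenation; $\overline{a}[k]$ denotes the word of $k$ letters all equal to $a$. -}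

module Defs where

open import Data.Bool using (Bool; true; false; _xor_)
open import Data.Nat using (ℕ; zero; suc; _+_)
open import Data.Vec using (Vec; []; _∷_; replicate; _++_; count)
open import Relation.Nullary using (Dec)
open import Data.Bool.Properties using (T?)

-- F_2 is represented by Bool (false = 0, true = 1), addition is xor.

∂ : ∀ {n} → Vec Bool (suc n) → Vec Bool n
∂ (a ∷ []) = []
∂ (a ∷ b ∷ xs) = (a xor b) ∷ ∂ (b ∷ xs)

weight : ∀ {n} → Vec Bool n → ℕ
weight [] = 0
weight (true ∷ xs) = suc (weight xs)
weight (false ∷ xs) = weight xs

-- |T(x)| = Σ_{i=0}^{n-1} |∂^i x|  (for n = 0 the triangle is empty)
triangleWeight : ∀ {n} → Vec Bool n → ℕ
triangleWeight [] = 0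
triangleWeight {suc n} x = weight x + triangleWeight (∂ x)

zeros : ∀ n → Vec Bool n
zeros n = replicate n false

const : ∀ k → Bool → Vec Bool k
const k a = replicate k a

module Submission where

-- Induct on n via the discrete antiderivative: x is recovered from its first
-- letter and ∂x, and |T(x)| = |x| + |T(∂x)|. If ∂x is a nonzero word outside A,
-- induction gives |T(∂x)| > n − 1 and |x| ≥ 1 finishes. Otherwise ∂x ∈ A ∪ {0},
-- so x is constant, 1·0ⁿ⁻¹, 0ⁿ⁻¹·1 (all excluded), or one of 0·1ⁿ⁻¹, 1ⁿ⁻¹·0 and
-- the alternating words, whose weight is at least 2 while |T(∂x)| = n − 1.
-- The base case n = 4 is checked by evaluation (it fails for n = 3: 010).

open import Defs
open import Data.Bool using (Bool; true; false; _xor_)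
open import Data.Bool.Properties using (not-involutive)
open import Data.Nat using (ℕ; zero; suc; _+_; _≤_; _≥_; _>_; z≤n; s≤s)
open import Data.Nat.Properties using (+-mono-≤; +-identityʳ; ≤-reflexive; <ᵇ⇒<)
open import Data.Empty using (⊥-elim)
open import Data.Sum using (_⊎_; inj₁; inj₂)
open import Data.Vec using (Vec; []; _∷_; _∷ʳ_)
open import Relation.Binary.PropositionalEquality
  using (_≡_; _≢_; refl; cong; cong₂; subst; sym)
open Relation.Binary.PropositionalEquality.≡-Reasoning

integrate : ∀ {n} → Bool → Vec Bool n → Vec Bool (suc n)
integrate a []       = a ∷ []
integrate a (d ∷ ds) = a ∷ integrate (a xor d) ds

xor-cancelˡ : ∀ a b → a xor (a xor b) ≡ b
xor-cancelˡ false b = refl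
xor-cancelˡ true  b = not-involutive b

integrate-∂ : ∀ {n} a (xs : Vec Bool n) → integrate a (∂ (a ∷ xs)) ≡ a ∷ xs
integrate-∂ a []       = refl
integrate-∂ a (b ∷ xs) rewrite xor-cancelˡ a b = cong (a ∷_) (integrate-∂ b xs)

∂-integrate : ∀ {n} a (d : Vec Bool n) → ∂ (integrate a d) ≡ d
∂-integrate a []           = refl
∂-integrate a (d ∷ [])     = cong (_∷ []) (xor-cancelˡ a d)
∂-integrate a (d ∷ e ∷ ds) = cong₂ _∷_ (xor-cancelˡ a d) (∂-integrate (a xor d) (e ∷ ds))

integrate-zeros : ∀ n a → integrate a (zeros n) ≡ const (suc n) a
integrate-zeros zero    a     = refl
integrate-zeros (suc n) false = cong (false ∷_) (integrate-zeros n false)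
integrate-zeros (suc n) true  = cong (true ∷_) (integrate-zeros n true)

integrate-trailing-one : ∀ n → integrate false (zeros n ∷ʳ true) ≡ zeros (suc n) ∷ʳ true
integrate-trailing-one zero    = refl
integrate-trailing-one (suc n) = cong (false ∷_) (integrate-trailing-one n)

triangleWeight-integrate : ∀ {n} a (d : Vec Bool n) →
  triangleWeight (integrate a d) ≡ weight (integrate a d) + triangleWeight d
triangleWeight-integrate a []       = refl
triangleWeight-integrate a (d ∷ ds) =
  cong (λ v → weight (integrate a (d ∷ ds)) + triangleWeight v) (∂-integrate a (d ∷ ds))

triangleWeight-integrate-≥ : ∀ {n p q} a (d : Vec Bool n) →
  p ≤ weight (integrate a d) → q ≤ triangleWeight d → p + q ≤ triangleWeight (integrate a d)
triangleWeight-integrate-≥ a d p≤w q≤t =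
  subst (_ ≤_) (sym (triangleWeight-integrate a d)) (+-mono-≤ p≤w q≤t)

∂-const : ∀ n a → ∂ (const (suc n) a) ≡ zeros n
∂-const zero    a     = refl
∂-const (suc n) false = cong (false ∷_) (∂-const n false)
∂-const (suc n) true  = cong (false ∷_) (∂-const n true)

∂-leading-one : ∀ n → ∂ (true ∷ zeros (suc n)) ≡ true ∷ zeros n
∂-leading-one n = cong (true ∷_) (∂-const n false)

∂-trailing-one : ∀ n → ∂ (zeros (suc n) ∷ʳ true) ≡ zeros n ∷ʳ true
∂-trailing-one zero    = refl
∂-trailing-one (suc n) = cong (false ∷_) (∂-trailing-one n)

weight-zeros : ∀ n → weight (zeros n) ≡ 0
weight-zeros zero    = refl
weight-zeros (suc n) = weight-zeros n

weight-ones : ∀ n → weight (const n true) ≡ n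
weight-ones zero    = refl
weight-ones (suc n) = cong suc (weight-ones n)

weight-trailing-one : ∀ n → weight (zeros n ∷ʳ true) ≡ 1
weight-trailing-one zero    = refl
weight-trailing-one (suc n) = weight-trailing-one n

triangleWeight-zeros : ∀ n → triangleWeight (zeros n) ≡ 0
triangleWeight-zeros zero    = refl
triangleWeight-zeros (suc n) = begin
  weight (zeros (suc n)) + triangleWeight (∂ (zeros (suc n)))
    ≡⟨ cong₂ _+_ (weight-zeros n) (cong triangleWeight (∂-const n false)) ⟩
  triangleWeight (zeros n)
    ≡⟨ triangleWeight-zeros n ⟩
  0 ∎

triangleWeight-ones : ∀ n → triangleWeight (const n true) ≡ n
triangleWeight-ones zero    = refl
triangleWeight-ones (suc n) = begin
  weight (const (suc n) true) + triangleWeight (∂ (const (suc n) true))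
    ≡⟨ cong₂ _+_ (weight-ones (suc n)) (cong triangleWeight (∂-const n true)) ⟩
  suc n + triangleWeight (zeros n)
    ≡⟨ cong (suc n +_) (triangleWeight-zeros n) ⟩
  suc n + 0
    ≡⟨ +-identityʳ (suc n) ⟩
  suc n ∎

triangleWeight-leading-one : ∀ n → triangleWeight (true ∷ zeros n) ≡ suc n
triangleWeight-leading-one zero    = refl
triangleWeight-leading-one (suc n) = begin
  suc (weight (zeros (suc n)) + triangleWeight (∂ (true ∷ zeros (suc n))))
    ≡⟨ cong suc (cong₂ _+_ (weight-zeros (suc n)) (cong triangleWeight (∂-leading-one n))) ⟩
  suc (triangleWeight (true ∷ zeros n))
    ≡⟨ cong suc (triangleWeight-leading-one n) ⟩
  suc (suc n) ∎

triangleWeight-trailing-one : ∀ n → triangleWeight (zeros n ∷ʳ true) ≡ suc n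
triangleWeight-trailing-one zero    = refl
triangleWeight-trailing-one (suc n) = begin
  weight (zeros (suc n) ∷ʳ true) + triangleWeight (∂ (zeros (suc n) ∷ʳ true))
    ≡⟨ cong₂ _+_ (weight-trailing-one (suc n)) (cong triangleWeight (∂-trailing-one n)) ⟩
  suc (triangleWeight (zeros n ∷ʳ true))
    ≡⟨ cong suc (triangleWeight-trailing-one n) ⟩
  suc (suc n) ∎

-- The set A of the paper together with the zero word.
data Exceptional : ∀ {n} → Vec Bool n → Set where
  constant     : ∀ {n} a → Exceptional (const n a)
  leading-one  : ∀ {n} → Exceptional (true ∷ zeros n)
  trailing-one : ∀ {n} → Exceptional (zeros n ∷ʳ true)

zeros⊎weight>0 : ∀ {n} (x : Vec Bool n) → x ≡ zeros n ⊎ weight x > 0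
zeros⊎weight>0 []           = inj₁ refl
zeros⊎weight>0 (true  ∷ x) = inj₂ (s≤s z≤n)
zeros⊎weight>0 (false ∷ x) with zeros⊎weight>0 x
... | inj₁ x≡0  = inj₁ (cong (false ∷_) x≡0)
... | inj₂ w>0 = inj₂ w>0

alternating-weight≥2 : ∀ k a → weight (integrate a (const (4 + k) true)) ≥ 2
alternating-weight≥2 k false = s≤s (s≤s z≤n)
alternating-weight≥2 k true  = s≤s (s≤s z≤n)

Heavy : ∀ {n} → Vec Bool n → Set
Heavy {n} x = triangleWeight x > n

ExceptionalOrHeavy : ∀ {n} → Vec Bool n → Set
ExceptionalOrHeavy x = Exceptional x ⊎ Heavy x

heavy-integrate : ∀ {k} a (d : Vec Bool (4 + k)) →
  ExceptionalOrHeavy d → ExceptionalOrHeavy (integrate a d)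
heavy-integrate {k} a _ (inj₁ (constant false)) =
  inj₁ (subst Exceptional (sym (integrate-zeros (4 + k) a)) (constant a))
heavy-integrate {k} a _ (inj₁ (constant true)) =
  inj₂ (triangleWeight-integrate-≥ a (const (4 + k) true) (alternating-weight≥2 k a)
                                       (≤-reflexive (sym (triangleWeight-ones (4 + k)))))
heavy-integrate {k} true _ (inj₁ leading-one) =
  inj₁ (subst Exceptional (cong (true ∷_) (sym (integrate-zeros (3 + k) false))) leading-one)
heavy-integrate {k} false _ (inj₁ leading-one) =
  inj₂ (triangleWeight-integrate-≥ false (true ∷ zeros (3 + k)) (s≤s (s≤s z≤n))
                                           (≤-reflexive (sym (triangleWeight-leading-one (3 + k)))))
heavy-integrate {k} false _ (inj₁ trailing-one) =
  inj₁ (subst Exceptional (sym (integrate-trailing-one (3 + k))) trailing-one)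
heavy-integrate {k} true _ (inj₁ trailing-one) =
  inj₂ (triangleWeight-integrate-≥ true (zeros (3 + k) ∷ʳ true) (s≤s (s≤s z≤n))
                                          (≤-reflexive (sym (triangleWeight-trailing-one (3 + k)))))
heavy-integrate a d (inj₂ heavy) with zeros⊎weight>0 (integrate a d)
... | inj₁ x≡0 = inj₁ (subst Exceptional (sym x≡0) (constant false))
... | inj₂ w>0 = inj₂ (triangleWeight-integrate-≥ a d w>0 heavy)

exceptional⊎heavy : ∀ k (x : Vec Bool (4 + k)) → ExceptionalOrHeavy x
exceptional⊎heavy zero (false ∷ false ∷ false ∷ false ∷ []) = inj₁ (constant false)
exceptional⊎heavy zero (false ∷ false ∷ false ∷ true  ∷ []) = inj₁ trailing-one
exceptional⊎heavy zero (true  ∷ false ∷ false ∷ false ∷ []) = inj₁ leading-one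
exceptional⊎heavy zero (true  ∷ true  ∷ true  ∷ true  ∷ []) = inj₁ (constant true)
exceptional⊎heavy zero (false ∷ false ∷ true  ∷ false ∷ []) = inj₂ (<ᵇ⇒< 4 _ _)
exceptional⊎heavy zero (false ∷ false ∷ true  ∷ true  ∷ []) = inj₂ (<ᵇ⇒< 4 _ _)
exceptional⊎heavy zero (false ∷ true  ∷ false ∷ false ∷ []) = inj₂ (<ᵇ⇒< 4 _ _)
exceptional⊎heavy zero (false ∷ true  ∷ false ∷ true  ∷ []) = inj₂ (<ᵇ⇒< 4 _ _)
exceptional⊎heavy zero (false ∷ true  ∷ true  ∷ false ∷ []) = inj₂ (<ᵇ⇒< 4 _ _)
exceptional⊎heavy zero (false ∷ true  ∷ true  ∷ true  ∷ []) = inj₂ (<ᵇ⇒< 4 _ _)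
exceptional⊎heavy zero (true  ∷ false ∷ false ∷ true  ∷ []) = inj₂ (<ᵇ⇒< 4 _ _)
exceptional⊎heavy zero (true  ∷ false ∷ true  ∷ false ∷ []) = inj₂ (<ᵇ⇒< 4 _ _)
exceptional⊎heavy zero (true  ∷ false ∷ true  ∷ true  ∷ []) = inj₂ (<ᵇ⇒< 4 _ _)
exceptional⊎heavy zero (true  ∷ true  ∷ false ∷ false ∷ []) = inj₂ (<ᵇ⇒< 4 _ _)
exceptional⊎heavy zero (true  ∷ true  ∷ false ∷ true  ∷ []) = inj₂ (<ᵇ⇒< 4 _ _)
exceptional⊎heavy zero (true  ∷ true  ∷ true  ∷ false ∷ []) = inj₂ (<ᵇ⇒< 4 _ _)
exceptional⊎heavy (suc k) (a ∷ xs) =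
  subst ExceptionalOrHeavy (integrate-∂ a xs) (heavy-integrate a (∂ (a ∷ xs)) (exceptional⊎heavy k (∂ (a ∷ xs))))

proposition4p3 : (m : ℕ) → suc m ≥ 4 → (x : Vec Bool (suc m))
    → x ≢ zeros (suc m)
    → x ≢ const (suc m) true
    → x ≢ true ∷ const m false
    → x ≢ const m false ∷ʳ true
    → triangleWeight x > suc m
proposition4p3 _ (s≤s (s≤s (s≤s (s≤s {n = k} _)))) x x≢0 x≢1 x≢e₀ x≢eₙ
  with exceptional⊎heavy k x
... | inj₁ (constant false) = ⊥-elim (x≢0 refl)
... | inj₁ (constant true)  = ⊥-elim (x≢1 refl)
... | inj₁ leading-one      = ⊥-elim (x≢e₀ refl)
... | inj₁ trailing-one     = ⊥-elim (x≢eₙ refl)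
... | inj₂ heavy            = heavy
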